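{- The anti-lexicographic ordering of $\mathbb{M}$ is labeling-consistent.
   Context: All graphs are finite. A rooted network is a directed acyclic graph $G=(V,E)$ with a unique vertex $\rho$ of in-degree $0$ (the root). A leaf is a vertex of out-degree $0$; non-leaf vertices are interior vertices; $C_u$ is the set of children of $u$. Let $\mathbb{N}^*=\{1,2,3,\dots\}$. A leaf labeling is any map $\lambda$ from the set of leaves to $\mathbb{N}^*$ (not necessarily injective); a leaf-labeled tree is a rooted network with a leaf labeling in which every vertex has in-degree at most $1$. $\mathbb{M}$ is the set of all finite non-empty multisets of elements of $\mathbb{N}^*$; $M(x)$ is the multiplicity of $x$ in $M$. An ordering of $\mathbb{M}$ is a total order on $\mathbb{M}$. The anti-lexicographic ordering: $M\preceq M'$ if either $M=M'$ or $M(x)<M'(x)$ for the largest $x\in\mathbb{N}^*$ with $M(x)\neq M'(x)$. For a full labeling $\phi:V\to\mathbb{N}^*$ and an interior vertex $u$, $F_{(u,\phi)}$ is the multiset $\{\phi(v):v\in C_u\}$. Algorithm 1 (input: $\preceq$ and a leaf-labeled network $(\mathcal{N},\lambda)$): set $\phi(v)=\lambda(v)$ for every leaf $v$; set $\mathbb{L}$ = set of leaf labels and $U$ = set of interior vertices. While $U\neq\emptyset$: let $W$ be the set of $u\in U$ all of whose children already have a label; let $W'$ be the set of $w\in W$ with $F_{(w,\phi)}$ equal to the $\preceq$-minimum of $\{F_{(w',\phi)}:w'\in W\}$; let $k=\min(\mathbb{N}^*\setminus\mathbb{L})$; set $\phi(w)=k$ for $w\in W'$; add $k$ to $\mathbb{L}$;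 remove $W'$ from $U$. The output is denoted $\phi_{(\lambda,\preceq)}$. For a leaf-labeled tree $(\mathcal{T},\lambda)$, $M_{(\mathcal{T},\lambda)}$ is the multiset of leaf labels. $A\in\mathbb{M}$ is gap-less if $A(x)\ge1$ for all $1\le x\le\max(A)$. An ordering $\preceq$ of $\mathbb{M}$ is labeling-consistent if for every leaf-labeled tree $(\mathcal{T},\lambda)$ with $M_{(\mathcal{T},\lambda)}$ gap-less and all interior vertices $u,v$, with $\phi=\phi_{(\lambda,\preceq)}$, $\phi(u)\le\phi(v)$ implies $F_{(u,\phi)}\preceq F_{(v,\phi)}$. -}

module Defs where

open import Data.Nat using (ℕ; zero; suc; _≤_; _<_; _≡ᵇ_)
open import Data.Bool using (Bool; true; false; _∧_)
open import Data.Fin using (Fin)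
open import Data.List using (List; length; filterᵇ; allFin)
open import Data.Maybe using (Maybe; just; nothing)
open import Data.Product using (Σ; ∃; _×_; _,_)
open import Data.Sum using (_⊎_)
open import Relation.Nullary using (¬_)
open import Relation.Binary.PropositionalEquality using (_≡_)
open import Relation.Binary.Construct.Closure.Transitive using (TransClosure)
open import Relation.Binary.Construct.Closure.ReflexiveTransitive using (Star)

-- Multisets of ℕ* are represented by their multiplicity functions
-- (finite support / non-emptiness are automatic for all multisets that
-- arise below: multisets of labels of the children of an interior vertex).

Mult : Set
Mult = ℕ → ℕ

Ordering : Set₁
Ordering = Mult → Mult → Set

AntiLex : Ordering
AntiLex M M' =
  (∀ x → M x ≡ M' x) ⊎
  Σ ℕ (λ x → M x < M' x × (∀ y → x < y → M y ≡ M' y))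

Graph : ℕ → Set
Graph n = Fin n → Fin n → Bool

module _ {n : ℕ} (E : Graph n) where

  Edge : Fin n → Fin n → Set
  Edge u v = E u v ≡ true

  inDeg : Fin n → ℕ
  inDeg v = length (filterᵇ (λ u → E u v) (allFin n))

  Leaf : Fin n → Set
  Leaf u = ∀ v → E u v ≡ false

  Interior : Fin n → Set
  Interior u = ¬ Leaf u

record RootedTree (n : ℕ) : Set where
  field
    E           : Graph n
    acyclic     : ∀ v → ¬ TransClosure (Edge E) v v
    root        : Fin n
    root-indeg  : inDeg E root ≡ 0
    root-unique : ∀ v → inDeg E v ≡ 0 → v ≡ root
    indeg≤1     : ∀ v → inDeg E v ≤ 1

-- Leaf labeling: values into ℕ* on leaves (values on interior vertices
-- are irrelevant and never used).
LeafLabeling : ∀ {n} → Graph n → (Fin n → ℕ) → Set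
LeafLabeling E lam = ∀ v → Leaf E v → 1 ≤ lam v

GapLess : ∀ {n} → Graph n → (Fin n → ℕ) → Set
GapLess E lam =
  ∀ x → 1 ≤ x → (∀ v → Leaf E v → x ≤ lam v → ∃ λ w → Leaf E w × lam w ≡ x)

isLab : Maybe ℕ → ℕ → Bool
isLab nothing  x = false
isLab (just y) x = y ≡ᵇ x

childMult : ∀ {n} → Graph n → (Fin n → Maybe ℕ) → Fin n → Mult
childMult {n} E φ u x = length (filterᵇ (λ v → E u v ∧ isLab (φ v) x) (allFin n))

-- Algorithm 1, as a relational (small-step) specification.

record State (n : ℕ) : Set₁ where
  field
    lab : Fin n → Maybe ℕ      -- φ (nothing = not yet labeled)
    L   : ℕ → Set
    U   : Fin n → Bool
open State public

module Algo {n : ℕ} (_⪯_ : Ordering) (E : Graph n) (lam : Fin n → ℕ) where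

  Init : State n → Set
  Init s =
    (∀ v → (Leaf E v → lab s v ≡ just (lam v)) × (Interior E v → lab s v ≡ nothing)) ×
    (∀ x → (L s x → ∃ λ v → Leaf E v × lam v ≡ x) × ((∃ λ v → Leaf E v × lam v ≡ x) → L s x)) ×
    (∀ v → (U s v ≡ true → Interior E v) × (Interior E v → U s v ≡ true))

  InW : State n → Fin n → Set
  InW s u = U s u ≡ true × (∀ v → Edge E u v → ∃ λ x → lab s v ≡ just x)

  F : State n → Fin n → Mult
  F s = childMult E (lab s)

  InW' : State n → Fin n → Set
  InW' s u = InW s u × (∀ w → InW s w → F s u ⪯ F s w)

  MinFresh : (ℕ → Set) → ℕ → Set
  MinFresh Lset k = 1 ≤ k × ¬ Lset k × (∀ j → 1 ≤ j → j < k → Lset j)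

  record Step (s s' : State n) : Set where
    field
      U-nonempty : ∃ λ u → U s u ≡ true
      k          : ℕ
      k-fresh    : MinFresh (L s) k
      lab-new    : ∀ u → InW' s u → lab s' u ≡ just k
      lab-old    : ∀ u → ¬ InW' s u → lab s' u ≡ lab s u
      L-upd      : ∀ x → (L s' x → x ≡ k ⊎ L s x) × (x ≡ k ⊎ L s x → L s' x)
      U-upd      : ∀ u → (U s' u ≡ true → U s u ≡ true × ¬ InW' s u)
                       × (U s u ≡ true × ¬ InW' s u → U s' u ≡ true)

  Output : (Fin n → ℕ) → Set₁
  Output φ = Σ (State n) λ s₀ → Σ (State n) λ s →
    Init s₀ × Star Step s₀ s × (∀ u → U s u ≡ false) × (∀ v → lab s v ≡ just (φ v))

LabelingConsistent : Ordering → Set₁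
LabelingConsistent _⪯_ =
  ∀ n (T : RootedTree n) (lam : Fin n → ℕ) →
  let E = RootedTree.E T in
  LeafLabeling E lam → GapLess E lam →
  ∀ (φ : Fin n → ℕ) → Algo.Output _⪯_ E lam φ →
  ∀ u v → Interior E u → Interior E v →
  φ u ≤ φ v → childMult E (λ w → just (φ w)) u ⪯ childMult E (λ w → just (φ w)) v

-- Algorithm 1 hands out labels in increasing order, and the set of used labels is always an
-- initial segment of ℕ* (this is where gap-lessness enters). Take interior u, v with
-- φ u ≤ φ v and look at the step at which u is labelled: v is still pending then. If all
-- children of v are already labelled, F u ⪯ F v is the minimality of F u at that step.
-- Otherwise v has a child c that is labelled later, with a label exceeding every used label,
-- in particular every child label of u; a multiset containing such an element is
-- anti-lexicographically larger.
-- Because the algorithm is specified relationally, whether a vertex is selected at a step is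
-- not decidable; the case analysis is therefore done under double negation, which is harmless
-- since anti-lexicographic comparison of finitely supported multiplicities is decidable.
module Submission where

open import Defs
open import Data.Bool using (Bool; true; false; T; T?; _∧_)
open import Data.Bool.Properties using (T-≡; T-∧)
open import Data.Fin using (Fin)
open import Data.List using (length; filterᵇ; allFin; map)
open import Data.List.Extrema.Nat using (max; xs≤max)
open import Data.List.Membership.Propositional using (lose)
open import Data.List.Membership.Propositional.Properties using (∈-allFin; ∈-map⁺)
open import Data.List.Properties using (filter-≐; filter-none; filter-some)
import Data.List.Relation.Unary.All as All
open import Data.Maybe using (Maybe; just; nothing)
open import Data.Maybe.Properties using (just-injective)
open import Data.Nat using (ℕ; zero; suc; _≤_; _<_; _≤?_; _<?_; _≟_; z<s; z≤n)
open import Data.Nat.Properties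
open import Data.Product using (∃; _×_; _,_; proj₁; proj₂)
open import Data.Sum using (_⊎_; inj₁; inj₂)
open import Function using (_∘_; Equivalence)
open import Relation.Nullary using (¬_; Dec; yes; no; contradiction; ¬¬-map)
open import Relation.Nullary.Decidable using (decidable-stable; ¬¬-excluded-middle)
open import Relation.Binary using (tri<; tri≈; tri>)
open import Relation.Binary.PropositionalEquality
  using (_≡_; _≢_; _≗_; refl; sym; trans; cong; subst; subst₂)
open import Relation.Binary.Construct.Closure.ReflexiveTransitive using (Star; ε; _◅_)

AgreeAbove : ℕ → Mult → Mult → Set
AgreeAbove B M M' = ∀ y → B < y → M y ≡ M' y

agreeAbove-pred : ∀ {B M M'} → AgreeAbove (suc B) M M' → M (suc B) ≡ M' (suc B) → AgreeAbove B M M'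
agreeAbove-pred above eq y B<y with m≤n⇒m<n∨m≡n B<y
... | inj₁ 1+B<y = above y 1+B<y
... | inj₂ refl  = eq

lastDifference : ∀ B {M M'} → AgreeAbove B M M' →
                 M ≗ M' ⊎ ∃ λ x → M x ≢ M' x × AgreeAbove x M M'
lastDifference zero {M} {M'} above with M 0 ≟ M' 0
... | yes eq  = inj₁ λ { zero → eq ; (suc y) → above (suc y) z<s }
... | no  neq = inj₂ (0 , neq , above)
lastDifference (suc B) {M} {M'} above with M (suc B) ≟ M' (suc B)
... | yes eq  = lastDifference B (agreeAbove-pred above eq)
... | no  neq = inj₂ (suc B , neq , above)

lastDifference-unique : ∀ {M M' x x'} →
                        M x ≢ M' x → AgreeAbove x M M' →
                        M x' ≢ M' x' → AgreeAbove x' M M' → x ≡ x'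
lastDifference-unique {x = x} {x'} neq above neq' above' with <-cmp x x'
... | tri< x<x' _ _ = contradiction (above x' x<x') neq'
... | tri≈ _ x≡x' _ = x≡x'
... | tri> _ _ x'<x = contradiction (above' x x'<x) neq

antiLex? : ∀ B {M M'} → AgreeAbove B M M' → Dec (AntiLex M M')
antiLex? B {M} {M'} above with lastDifference B above
... | inj₁ M≗M' = yes (inj₁ M≗M')
... | inj₂ (x , neq , above-x) with M x <? M' x
...   | yes lt = yes (inj₂ (x , lt , above-x))
...   | no ≮   = no λ
  { (inj₁ M≗M') → neq (M≗M' x)
  ; (inj₂ (x' , lt , above-x')) →
      ≮ (subst (λ z → M z < M' z) (lastDifference-unique (<⇒≢ lt) above-x' neq above-x) lt) }

antiLex-resp-≗ : ∀ {M₁ M₂ M₁' M₂'} → M₁ ≗ M₂ → M₁' ≗ M₂' → AntiLex M₁ M₁' → AntiLex M₂ M₂'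
antiLex-resp-≗ eq eq' (inj₁ M₁≗M₁') = inj₁ λ x → trans (sym (eq x)) (trans (M₁≗M₁' x) (eq' x))
antiLex-resp-≗ eq eq' (inj₂ (x , lt , above)) =
  inj₂ (x , subst₂ _<_ (eq x) (eq' x) lt ,
        λ y x<y → trans (sym (eq y)) (trans (above y x<y) (eq' y)))

antiLex-exceeding : ∀ B t {M M'} → AgreeAbove B M M' →
                    (∀ y → t ≤ y → M y ≡ 0) → 0 < M' t → AntiLex M M'
antiLex-exceeding B t {M} {M'} above M≥t≡0 0<M't = fromLastDifference (lastDifference B above)
  where
  Mt<M't : M t < M' t
  Mt<M't = subst (_< M' t) (sym (M≥t≡0 t ≤-refl)) 0<M't

  fromLastDifference : M ≗ M' ⊎ ∃ (λ x → M x ≢ M' x × AgreeAbove x M M') → AntiLex M M'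
  fromLastDifference (inj₁ M≗M') = contradiction (M≗M' t) (<⇒≢ Mt<M't)
  fromLastDifference (inj₂ (x , neq , above-x)) with t ≤? x
  ... | yes t≤x = inj₂ (x , ≤∧≢⇒< (subst (_≤ M' x) (sym (M≥t≡0 x t≤x)) z≤n) neq , above-x)
  ... | no  t≰x = contradiction (above-x t (≰⇒> t≰x)) (<⇒≢ Mt<M't)

filterᵇ-cong : ∀ {A : Set} {p q : A → Bool} → (∀ a → p a ≡ q a) → ∀ xs → filterᵇ p xs ≡ filterᵇ q xs
filterᵇ-cong {p = p} {q} p≗q =
  filter-≐ (T? ∘ p) (T? ∘ q) ((λ {a} → subst T (p≗q a)) , (λ {a} → subst T (sym (p≗q a))))

isLab⇒≡just : ∀ m x → T (isLab m x) → m ≡ just x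
isLab⇒≡just (just y) x t = cong just (≡ᵇ⇒≡ y x t)

isLab-just : ∀ x → T (isLab (just x) x)
isLab-just x = ≡⇒≡ᵇ x x refl

just≢nothing : ∀ {x : ℕ} → just x ≢ nothing
just≢nothing ()

module _ {n : ℕ} (E : Graph n) where

  private
    counted : (Fin n → Maybe ℕ) → Fin n → ℕ → Fin n → Bool
    counted ψ u x v = E u v ∧ isLab (ψ v) x

  childMult-cong : ∀ {ψ ψ' : Fin n → Maybe ℕ} u →
                   (∀ v → Edge E u v → ψ v ≡ ψ' v) → childMult E ψ u ≗ childMult E ψ' u
  childMult-cong {ψ} {ψ'} u ψ≡ψ' x = cong length (filterᵇ-cong counted-same (allFin n))
    where
    counted-same : ∀ v → counted ψ u x v ≡ counted ψ' u x v
    counted-same v with E u v in e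
    ... | false = refl
    ... | true  = cong (λ m → isLab m x) (ψ≡ψ' v e)

  childMult-zero : ∀ {ψ : Fin n → Maybe ℕ} u x →
                   (∀ v → Edge E u v → ψ v ≢ just x) → childMult E ψ u x ≡ 0
  childMult-zero {ψ} u x none =
    cong length (filter-none (T? ∘ counted ψ u x) (All.universal not-counted (allFin n)))
    where
    not-counted : ∀ v → ¬ T (counted ψ u x v)
    not-counted v t with Equivalence.to T-∧ t
    ... | e , l = none v (Equivalence.to T-≡ e) (isLab⇒≡just (ψ v) x l)

  childMult-pos : ∀ {ψ : Fin n → Maybe ℕ} u v x →
                  Edge E u v → ψ v ≡ just x → 0 < childMult E ψ u x
  childMult-pos {ψ} u v x e ψv≡x = filter-some (T? ∘ counted ψ u x) (lose (∈-allFin v) v-counted)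
    where
    v-counted : T (counted ψ u x v)
    v-counted = Equivalence.from T-∧
      (Equivalence.from T-≡ e , subst (λ m → T (isLab m x)) (sym ψv≡x) (isLab-just x))

module Invariants {n : ℕ} (_⪯_ : Ordering) (E : Graph n) (lam : Fin n → ℕ) where
  open Algo _⪯_ E lam

  record Invariant (s : State n) : Set where
    field
      used-positive      : ∀ {x} → L s x → 1 ≤ x
      used-downClosed    : ∀ {x y} → L s x → 1 ≤ y → y ≤ x → L s y
      label-used         : ∀ {v x} → lab s v ≡ just x → ¬ ¬ L s x
      pending-unlabelled : ∀ {v} → U s v ≡ true → lab s v ≡ nothing

    unused-exceeds-used : ∀ {x y} → L s x → 1 ≤ y → ¬ L s y → x < y
    unused-exceeds-used Lx 1≤y ¬Ly = ≰⇒> λ y≤x → ¬Ly (used-downClosed Lx 1≤y y≤x)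

    labelled-unselected : ∀ {v x} → lab s v ≡ just x → ¬ InW' s v
    labelled-unselected labelled ((pending , _) , _) =
      just≢nothing (trans (sym labelled) (pending-unlabelled pending))

  init-invariant : LeafLabeling E lam → GapLess E lam → ∀ {s} → Init s → Invariant s
  init-invariant positive gapless {s} (init-lab , init-L , init-U) = record
    { used-positive      = used-positive
    ; used-downClosed    = used-downClosed
    ; label-used         = label-used
    ; pending-unlabelled = λ {v} pending → proj₂ (init-lab v) (proj₁ (init-U v) pending)
    }
    where
    used-positive : ∀ {x} → L s x → 1 ≤ x
    used-positive {x} Lx with proj₁ (init-L x) Lx
    ... | v , leaf , refl = positive v leaf
    used-downClosed : ∀ {x y} → L s x → 1 ≤ y → y ≤ x → L s y
    used-downClosed {x} {y} Lx 1≤y y≤x with proj₁ (init-L x) Lx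
    ... | v , leaf , refl = proj₂ (init-L y) (gapless y 1≤y v leaf y≤x)
    label-used : ∀ {v x} → lab s v ≡ just x → ¬ ¬ L s x
    label-used {v} {x} labelled ¬Lx = ¬¬-excluded-middle λ
      { (yes leaf)     → ¬Lx (proj₂ (init-L x) (v , leaf , leaf-label leaf))
      ; (no  interior) → just≢nothing (trans (sym labelled) (proj₂ (init-lab v) interior)) }
      where
      leaf-label : Leaf E v → lam v ≡ x
      leaf-label leaf = just-injective (trans (sym (proj₁ (init-lab v) leaf)) labelled)

  module StepFacts {s s' : State n} (st : Step s s') where
    open Step st public

    k-positive : 1 ≤ k
    k-positive = proj₁ k-fresh

    k-unused : ¬ L s k
    k-unused = proj₁ (proj₂ k-fresh)

    below-k-used : ∀ j → 1 ≤ j → j < k → L s j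
    below-k-used = proj₂ (proj₂ k-fresh)

    used-grows : ∀ {x} → L s x → L s' x
    used-grows {x} Lx = proj₂ (L-upd x) (inj₂ Lx)

    k-used : L s' k
    k-used = proj₂ (L-upd k) (inj₁ refl)

    still-pending : ∀ {u} → U s u ≡ true → ¬ InW' s u → U s' u ≡ true
    still-pending {u} pending unselected = proj₂ (U-upd u) (pending , unselected)

  step-invariant : ∀ {s s'} → Invariant s → Step s s' → Invariant s'
  step-invariant {s} {s'} inv st = record
    { used-positive      = used-positive'
    ; used-downClosed    = used-downClosed'
    ; label-used         = label-used'
    ; pending-unlabelled = pending-unlabelled'
    }
    where
    open Invariant inv
    open StepFacts st

    used-positive' : ∀ {x} → L s' x → 1 ≤ x
    used-positive' {x} L'x with proj₁ (L-upd x) L'x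
    ... | inj₁ refl = k-positive
    ... | inj₂ Lx   = used-positive Lx

    used-downClosed' : ∀ {x y} → L s' x → 1 ≤ y → y ≤ x → L s' y
    used-downClosed' {x} {y} L'x 1≤y y≤x with proj₁ (L-upd x) L'x | m≤n⇒m<n∨m≡n y≤x
    ... | inj₂ Lx   | _          = used-grows (used-downClosed Lx 1≤y y≤x)
    ... | inj₁ refl | inj₁ y<k   = used-grows (below-k-used y 1≤y y<k)
    ... | inj₁ refl | inj₂ refl  = k-used

    label-used' : ∀ {v x} → lab s' v ≡ just x → ¬ ¬ L s' x
    label-used' {v} {x} labelled ¬L'x = ¬¬-excluded-middle λ
      { (yes selected)   →
          ¬L'x (subst (L s') (just-injective (trans (sym (lab-new v selected)) labelled)) k-used)
      ; (no  unselected) →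
          label-used (trans (sym (lab-old v unselected)) labelled) (¬L'x ∘ used-grows) }

    pending-unlabelled' : ∀ {v} → U s' v ≡ true → lab s' v ≡ nothing
    pending-unlabelled' {v} pending' with proj₁ (U-upd v) pending'
    ... | pending , unselected = trans (lab-old v unselected) (pending-unlabelled pending)

  run-invariant : ∀ {s s'} → Invariant s → Star Step s s' → Invariant s'
  run-invariant inv ε          = inv
  run-invariant inv (st ◅ run) = run-invariant (step-invariant inv st) run

  module FinalLabels {φ : Fin n → ℕ} {sf : State n} (final : ∀ v → lab sf v ≡ just (φ v)) where

    label-final : ∀ {s v x} → Invariant s → Star Step s sf → lab s v ≡ just x → φ v ≡ x
    label-final {v = v} _ ε labelled = just-injective (trans (sym (final v)) labelled)
    label-final {v = v} inv (st ◅ run) labelled =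
      label-final (step-invariant inv st) run
        (trans (lab-old v (labelled-unselected labelled)) labelled)
      where
      open Invariant inv
      open StepFacts st

    final-label-positive : ∀ {s} → Invariant s → Star Step s sf → ∀ v → 1 ≤ φ v
    final-label-positive inv run v =
      decidable-stable (1 ≤? φ v) (¬¬-map used-positive (label-used (final v)))
      where open Invariant (run-invariant inv run)

    unlabelled-final-unused : ∀ {s v} → Invariant s → Star Step s sf →
                              lab s v ≡ nothing → ¬ L s (φ v)
    unlabelled-final-unused {v = v} _ ε unlabelled =
      contradiction (trans (sym (final v)) unlabelled) just≢nothing
    unlabelled-final-unused {s} {v} inv (_◅_ {j = s'} st run) unlabelled Lφv = ¬¬-excluded-middle λ
      { (yes selected)   → k-unused (subst (L s) (label-final inv' run (lab-new v selected)) Lφv)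
      ; (no  unselected) → unlabelled-final-unused inv' run
                             (trans (lab-old v unselected) unlabelled) (used-grows Lφv) }
      where
      open StepFacts st
      inv' : Invariant s'
      inv' = step-invariant inv st

    labelled-below-unlabelled : ∀ {s w c x} → Invariant s → Star Step s sf →
                                lab s w ≡ just x → lab s c ≡ nothing → φ w < φ c
    labelled-below-unlabelled {s} {c = c} {x} inv run labelled unlabelled =
      subst (_< φ c) (sym (label-final inv run labelled))
        (decidable-stable (x <? φ c) (¬¬-map x<φc (label-used labelled)))
      where
      open Invariant inv
      x<φc : L s x → x < φ c
      x<φc Lx = unused-exceeds-used Lx (final-label-positive inv run c)
                  (unlabelled-final-unused inv run unlabelled)

module Consistency {n : ℕ} (E : Graph n) (lam : Fin n → ℕ) (φ : Fin n → ℕ) {sf : State n}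
                   (final : ∀ v → lab sf v ≡ just (φ v)) (finished : ∀ u → U sf u ≡ false) where
  open Algo AntiLex E lam
  open Invariants AntiLex E lam
  open FinalLabels {φ = φ} {sf = sf} final

  childLabels : Fin n → Mult
  childLabels = childMult E (just ∘ φ)

  maxLabel : ℕ
  maxLabel = max 0 (map φ (allFin n))

  label≤maxLabel : ∀ v → φ v ≤ maxLabel
  label≤maxLabel v = All.lookup (xs≤max 0 (map φ (allFin n))) (∈-map⁺ φ (∈-allFin v))

  childLabels-agreeAbove : ∀ u v → AgreeAbove maxLabel (childLabels u) (childLabels v)
  childLabels-agreeAbove u v y max<y = trans (vanish u) (sym (vanish v))
    where
    vanish : ∀ w → childLabels w y ≡ 0
    vanish w = childMult-zero E w y λ c _ φc≡y →
      <⇒≢ (≤-<-trans (label≤maxLabel c) max<y) (just-injective φc≡y)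

  _⊑_ : Fin n → Fin n → Set
  u ⊑ v = AntiLex (childLabels u) (childLabels v)

  ⊑-stable : ∀ u v → ¬ ¬ u ⊑ v → u ⊑ v
  ⊑-stable u v = decidable-stable (antiLex? maxLabel (childLabels-agreeAbove u v))

  module _ {s : State n} (inv : Invariant s) (run : Star Step s sf) where
    open Invariant inv

    ready-childMult : ∀ {w} → InW s w → F s w ≗ childLabels w
    ready-childMult {w} (_ , children-labelled) = childMult-cong E w final-child-label
      where
      final-child-label : ∀ c → Edge E w c → lab s c ≡ just (φ c)
      final-child-label c e with children-labelled c e
      ... | x , labelled = trans labelled (cong just (sym (label-final inv run labelled)))

    selected-vs-ready : ∀ {u v} → InW' s u → InW s v → u ⊑ v
    selected-vs-ready (ready-u , minimal) ready-v =
      antiLex-resp-≗ (ready-childMult ready-u) (ready-childMult ready-v) (minimal _ ready-v)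

    ready-vs-waiting : ∀ {u v c} → InW s u → Edge E v c → lab s c ≡ nothing → u ⊑ v
    ready-vs-waiting {u} {v} {c} (_ , children-labelled) e unlabelled =
      antiLex-exceeding maxLabel (φ c) (childLabels-agreeAbove u v) vanish-from-φc
        (childMult-pos E {just ∘ φ} v c (φ c) e refl)
      where
      child-label<φc : ∀ w → Edge E u w → φ w < φ c
      child-label<φc w e' = labelled-below-unlabelled inv run (proj₂ (children-labelled w e')) unlabelled
      vanish-from-φc : ∀ y → φ c ≤ y → childLabels u y ≡ 0
      vanish-from-φc y φc≤y = childMult-zero E u y λ w e' φw≡y →
        <⇒≱ (child-label<φc w e') (subst (φ c ≤_) (sym (just-injective φw≡y)) φc≤y)

    selected-vs-pending : ∀ {u v} → InW' s u → U s v ≡ true → u ⊑ v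
    selected-vs-pending {u} {v} selected@(ready-u , _) pending-v = ⊑-stable u v λ ¬goal →
      ¬goal (selected-vs-ready selected (pending-v , child-labelled ¬goal))
      where
      child-labelled : ¬ u ⊑ v → ∀ c → Edge E v c → ∃ λ x → lab s c ≡ just x
      child-labelled ¬goal c e with lab s c in l
      ... | just x  = x , refl
      ... | nothing = contradiction (ready-vs-waiting ready-u e l) ¬goal

  consistent : ∀ {s u v} → Invariant s → Star Step s sf → U s u ≡ true → U s v ≡ true →
               φ u ≤ φ v → u ⊑ v
  consistent {u = u} _ ε pending-u _ _ = contradiction (trans (sym pending-u) (finished u)) λ ()
  consistent {u = u} {v} inv (_◅_ {j = s'} st run) pending-u pending-v φu≤φv =
    ⊑-stable u v λ ¬goal → ¬¬-excluded-middle λ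
      { (yes selected-u)   → ¬goal (selected-vs-pending inv (st ◅ run) selected-u pending-v)
      ; (no  unselected-u) → ¬¬-excluded-middle λ
          { (yes selected-v)   → <⇒≱ (labelled-below-unlabelled inv' run (lab-new v selected-v)
                                    (pending-unlabelled (still-pending pending-u unselected-u))) φu≤φv
          ; (no  unselected-v) → ¬goal (consistent inv' run (still-pending pending-u unselected-u)
                                                  (still-pending pending-v unselected-v) φu≤φv) } }
    where
    open StepFacts st
    inv' : Invariant s'
    inv' = step-invariant inv st
    open Invariant inv' using (pending-unlabelled)

corollary4p2 : LabelingConsistent AntiLex
corollary4p2 n T lam positive gapless φ (s₀ , _ , init , run , finished , final) u v int-u int-v =
  consistent (init-invariant positive gapless init) run
    (initially-pending u int-u) (initially-pending v int-v)
  where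
  E : Graph n
  E = RootedTree.E T
  open Consistency E lam φ final finished
  open Invariants AntiLex E lam
  initially-pending : ∀ w → Interior E w → U s₀ w ≡ true
  initially-pending w = proj₂ (proj₂ (proj₂ init) w)
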